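{- Let $h \geq 2$ and let $k_0 = \left\lfloor \frac{1}{2^{1/h}-1} \right\rfloor + 1$. Let $r_1 < r_2 < \cdots < r_h$ be pairwise relatively prime positive integers, and let $P$ be a positive integer such that $P \geq r_h - r_1$ and such that, whenever $1 \leq i < j \leq h$ and a prime $p$ divides $r_j - r_i$, $p$ divides $P$. For every integer $k \geq 0$ define $s_{i,k} = kP + r_i$ for $i = 1,\ldots,h$ and $S_k = \prod_{i=1}^h s_{i,k}$. Choose an integer $k_1 \geq k_0$. Then for every positive integer $t$ there is a unique integer $\ell_t \geq -k_1$ such that \[ S_{k_1+\ell_t} \leq S_{k_1}^{t} < S_{k_1+\ell_t+1}. \] Moreover $\ell_1 = 0$ and the sequence $(\ell_t)_{t=1}^{\infty}$ is strictly increasing.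
   Context: $\lfloor \cdot \rfloor$ denotes the integer part. -}

module Defs where

open import Data.Nat as ℕ using (ℕ; zero; suc; _≤_; _^_)
open import Data.Fin using (Fin; zero; suc)
open import Data.Integer as ℤ using (ℤ)
open import Relation.Nullary using (¬_)

∏ℤ : ∀ n → (Fin n → ℤ) → ℤ
∏ℤ zero    f = ℤ.+ 1
∏ℤ (suc n) f = f zero ℤ.* ∏ℤ n (λ i → f (suc i))

_^ℤ_ : ℤ → ℕ → ℤ
x ^ℤ zero  = ℤ.+ 1
x ^ℤ suc t = x ℤ.* (x ^ℤ t)

-- "m = ⌊ 1 / (2^{1/h} - 1) ⌋".
-- For a natural number m and h ≥ 1 we have
--   m ≤ 1/(2^{1/h}-1)  ⇔  m·2^{1/h} ≤ m+1  ⇔  2·m^h ≤ (m+1)^h,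
-- so m is the floor iff m satisfies this and m+1 does not.
IsFloorInv : ℕ → ℕ → Set
IsFloorInv h m = (2 ℕ.* m ^ h ≤ suc m ^ h) × ¬ (2 ℕ.* suc m ^ h ≤ suc (suc m) ^ h)
  where open import Data.Product using (_×_)

Sseq : ∀ h → (r : Fin h → ℕ) → (P : ℕ) → ℤ → ℤ
Sseq h r P k = ∏ℤ h (λ i → k ℤ.* ℤ.+ P ℤ.+ ℤ.+ r i)

{-# OPTIONS --safe #-}
-- The map m ↦ S_m = ∏ᵢ (mP + rᵢ) is strictly increasing on ℕ, so every A ≥ S_0 lies in a
-- unique bracket S_m ≤ A < S_{m+1}; applying this to A = S_{k₁}^t gives ℓ_t = m − k₁.
-- Each factor satisfies (m+1)P + rᵢ ≤ (k₁P + rᵢ)(mP + rᵢ) once k₁ ≥ 1, hence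
-- S_{m+1} ≤ S_{k₁} S_m, and multiplying the bracket of S_{k₁}^t by S_{k₁} shows that the
-- bracket index strictly increases with t. The floor hypothesis on k₁ serves only to give
-- k₁ ≥ 1.
module Submission where

open import Defs
open import Data.Nat as ℕ using (ℕ; suc; _≤_; _<_; _∸_)
open import Data.Nat.Coprimality using (Coprime)
open import Data.Nat.Primality using (Prime)
open import Data.Nat.Divisibility using (_∣_)
open import Data.Fin as Fin using (Fin; zero; fromℕ)
open import Data.Integer as ℤ using (ℤ; +_; -_)
open import Data.Product using (_×_; Σ; _,_; ∃; proj₁; proj₂)
open import Relation.Binary.PropositionalEquality using (_≡_)

open import Data.Nat using (zero; z≤n; s≤s; _≤′_; ≤′-refl; ≤′-step)
import Data.Nat.Properties as ℕₚ
import Data.Integer.Properties as ℤₚ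
import Data.Nat.Solver as ℕ-Solver
open import Algebra.Properties.CommutativeMonoid.Sum ℕₚ.*-1-commutativeMonoid
  using () renaming (sum to ∏ℕ; ∑-distrib-+ to ∏-distrib-*)
open import Algebra.Bundles using (AbelianGroup)
open import Algebra.Properties.Group (AbelianGroup.group ℤₚ.+-0-abelianGroup)
  using (\\-leftDividesˡ; y≈x\\z)
open import Relation.Nullary using (¬_; yes; no; contradiction)
open import Relation.Unary using (Decidable)
open import Relation.Binary.PropositionalEquality
  using (refl; sym; trans; cong; cong₂; subst; subst₂; module ≡-Reasoning)

∏ℤ-+ : ∀ n (f : Fin n → ℕ) → ∏ℤ n (λ i → + f i) ≡ + ∏ℕ f
∏ℤ-+ zero    f = refl
∏ℤ-+ (suc n) f = trans (cong (+ f zero ℤ.*_) (∏ℤ-+ n _)) (sym (ℤₚ.pos-* (f zero) _))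

∏ℤ-cong : ∀ n {f g : Fin n → ℤ} → (∀ i → f i ≡ g i) → ∏ℤ n f ≡ ∏ℤ n g
∏ℤ-cong zero    f≡g = refl
∏ℤ-cong (suc n) f≡g = cong₂ ℤ._*_ (f≡g zero) (∏ℤ-cong n (λ i → f≡g (Fin.suc i)))

^ℤ-+ : ∀ a t → (+ a) ^ℤ t ≡ + (a ℕ.^ t)
^ℤ-+ a zero    = refl
^ℤ-+ a (suc t) = trans (cong (+ a ℤ.*_) (^ℤ-+ a t)) (sym (ℤₚ.pos-* a (a ℕ.^ t)))

∏-positive : ∀ n {f : Fin n → ℕ} → (∀ i → 1 ≤ f i) → 1 ≤ ∏ℕ f
∏-positive zero    pos = ℕₚ.≤-refl
∏-positive (suc n) pos = ℕₚ.*-mono-≤ (pos zero) (∏-positive n (λ i → pos (Fin.suc i)))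

∏-mono-≤ : ∀ n {f g : Fin n → ℕ} → (∀ i → f i ≤ g i) → ∏ℕ f ≤ ∏ℕ g
∏-mono-≤ zero    f≤g = ℕₚ.≤-refl
∏-mono-≤ (suc n) f≤g = ℕₚ.*-mono-≤ (f≤g zero) (∏-mono-≤ n (λ i → f≤g (Fin.suc i)))

*-mono-<-≤ : ∀ {a b c d} → a < c → b ≤ d → 1 ≤ b → a ℕ.* b < c ℕ.* d
*-mono-<-≤ {a} {b} {c} {d} a<c b≤d 1≤b =
  ℕₚ.≤-<-trans (ℕₚ.*-monoʳ-≤ a b≤d)
    (ℕₚ.*-monoˡ-< d {{ℕ.>-nonZero (ℕₚ.≤-trans 1≤b b≤d)}} a<c)

∏-mono-< : ∀ n {f g : Fin (suc n) → ℕ} → (∀ i → 1 ≤ f i) → (∀ i → f i < g i) →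
           ∏ℕ f < ∏ℕ g
∏-mono-< n pos f<g = *-mono-<-≤ (f<g zero)
  (∏-mono-≤ n (λ i → ℕₚ.<⇒≤ (f<g (Fin.suc i))))
  (∏-positive n (λ i → pos (Fin.suc i)))

last-before-failure : ∀ {Q : ℕ → Set} → Decidable Q →
                      ∀ N → Q 0 → ¬ Q N → ∃ λ m → Q m × ¬ Q (suc m)
last-before-failure Q? zero    q₀ ¬q = contradiction q₀ ¬q
last-before-failure Q? (suc N) q₀ ¬q with Q? N
... | yes q = N , q , ¬q
... | no ¬q′ = last-before-failure Q? N q₀ ¬q′

module StrictlyIncreasing (f : ℕ → ℕ) (f-step : ∀ m → f m < f (suc m)) where

  Brackets : ℕ → ℕ → Set
  Brackets A m = f m ≤ A × A < f (suc m)

  ≤-mono : ∀ {m n} → m ≤ n → f m ≤ f n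
  ≤-mono m≤n = go (ℕₚ.≤⇒≤′ m≤n)
    where
    go : ∀ {m n} → m ≤′ n → f m ≤ f n
    go ≤′-refl      = ℕₚ.≤-refl
    go (≤′-step le) = ℕₚ.≤-trans (go le) (ℕₚ.<⇒≤ (f-step _))

  <-mono : ∀ {m n} → m < n → f m < f n
  <-mono {m} m<n = ℕₚ.<-≤-trans (f-step m) (≤-mono m<n)

  n≤f[n] : ∀ n → n ≤ f n
  n≤f[n] zero    = z≤n
  n≤f[n] (suc n) = ℕₚ.≤-<-trans (n≤f[n] n) (f-step n)

  brackets-index-≤ : ∀ {A m n} → f m ≤ A → A < f (suc n) → m ≤ n
  brackets-index-≤ {A} {m} {n} fm≤A A<fn+1 with m ℕ.≤? n
  ... | yes m≤n = m≤n
  ... | no m≰n  = contradiction (ℕₚ.≤-trans (≤-mono (ℕₚ.≰⇒> m≰n)) fm≤A) (ℕₚ.<⇒≱ A<fn+1)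

  brackets-unique : ∀ {A m n} → Brackets A m → Brackets A n → m ≡ n
  brackets-unique (lo₁ , hi₁) (lo₂ , hi₂) =
    ℕₚ.≤-antisym (brackets-index-≤ lo₁ hi₂) (brackets-index-≤ lo₂ hi₁)

  brackets : ∀ A → f 0 ≤ A → ∃ (Brackets A)
  brackets A f0≤A with last-before-failure (λ m → f m ℕ.≤? A) (suc A) f0≤A
                         (ℕₚ.<⇒≱ (ℕₚ.<-≤-trans (ℕₚ.n<1+n A) (n≤f[n] (suc A))))
  ... | m , fm≤A , fm+1≰A = m , fm≤A , ℕₚ.≰⇒> fm+1≰A

-- Bernoulli's inequality (1 + 1/j)⁻ʰ ≥ 1 − h/j, cleared of denominators.
bernoulli : ∀ h j → suc j ℕ.^ h ℕ.* j ≤ j ℕ.^ suc h ℕ.+ h ℕ.* suc j ℕ.^ h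
bernoulli zero    j = ℕₚ.≤-reflexive (cong (ℕ._+ 0) (sym (ℕₚ.*-identityʳ j)))
bernoulli (suc h) j = begin
  suc j ℕ.* Y ℕ.* j                     ≡⟨ ℕₚ.*-assoc (suc j) Y j ⟩
  suc j ℕ.* (Y ℕ.* j)                   ≤⟨ ℕₚ.*-monoʳ-≤ (suc j) (bernoulli h j) ⟩
  suc j ℕ.* (j ℕ.* X ℕ.+ h ℕ.* Y)       ≡⟨ expand ⟩
  j ℕ.* (j ℕ.* X) ℕ.+ (j ℕ.* X ℕ.+ h ℕ.* (suc j ℕ.* Y))
    ≤⟨ ℕₚ.+-monoʳ-≤ (j ℕ.* (j ℕ.* X)) (ℕₚ.+-monoˡ-≤ (h ℕ.* (suc j ℕ.* Y)) jX≤[1+j]Y) ⟩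
  j ℕ.* (j ℕ.* X) ℕ.+ (suc j ℕ.* Y ℕ.+ h ℕ.* (suc j ℕ.* Y)) ∎
  where
  open ℕₚ.≤-Reasoning
  open ℕ-Solver.+-*-Solver
  X Y : ℕ
  X = j ℕ.^ h
  Y = suc j ℕ.^ h
  jX≤[1+j]Y : j ℕ.* X ≤ suc j ℕ.* Y
  jX≤[1+j]Y = ℕₚ.^-monoˡ-≤ (suc h) (ℕₚ.n≤1+n j)
  expand : suc j ℕ.* (j ℕ.* X ℕ.+ h ℕ.* Y)
         ≡ j ℕ.* (j ℕ.* X) ℕ.+ (j ℕ.* X ℕ.+ h ℕ.* (suc j ℕ.* Y))
  expand = solve 4 (λ j X Y h → (con 1 :+ j) :* (j :* X :+ h :* Y)
                              := j :* (j :* X) :+ (j :* X :+ h :* ((con 1 :+ j) :* Y))) refl j X Y h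

-- That is, 1 / (2^{1/h} − 1) < 2h + 1.
¬2j^h≤[1+j]^h : ∀ h → let j = suc (2 ℕ.* h) in ¬ (2 ℕ.* j ℕ.^ h ≤ suc j ℕ.^ h)
¬2j^h≤[1+j]^h h 2X≤Y = ℕₚ.<⇒≱ (ℕₚ.*-monoˡ-< X {{ℕₚ.m^n≢0 j h}} (ℕₚ.n<1+n j)) (begin
  suc j ℕ.* X
    ≡⟨ solve 2 (λ X h → (con 2 :+ con 2 :* h) :* X := con 2 :* X :* (con 1 :+ h)) refl X h ⟩
  2 ℕ.* X ℕ.* suc h    ≤⟨ ℕₚ.*-monoˡ-≤ (suc h) 2X≤Y ⟩
  Y ℕ.* suc h          ≤⟨ Y[1+h]≤jX ⟩
  j ℕ.* X              ∎)
  where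
  open ℕₚ.≤-Reasoning
  open ℕ-Solver.+-*-Solver
  j X Y : ℕ
  j = suc (2 ℕ.* h)
  X = j ℕ.^ h
  Y = suc j ℕ.^ h
  Y[1+h]≤jX : Y ℕ.* suc h ≤ j ℕ.* X
  Y[1+h]≤jX = ℕₚ.+-cancelʳ-≤ (h ℕ.* Y) _ _ (begin
    Y ℕ.* suc h ℕ.+ h ℕ.* Y
      ≡⟨ solve 2 (λ Y h → Y :* (con 1 :+ h) :+ h :* Y := Y :* (con 1 :+ con 2 :* h)) refl Y h ⟩
    Y ℕ.* j                 ≤⟨ bernoulli h j ⟩
    j ℕ.* X ℕ.+ h ℕ.* Y     ∎)

floorInv-exists : ∀ h → ∃ (IsFloorInv (suc h))
floorInv-exists h =
  last-before-failure (λ m → 2 ℕ.* m ℕ.^ suc h ℕ.≤? suc m ℕ.^ suc h)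
    (suc (2 ℕ.* suc h)) z≤n (¬2j^h≤[1+j]^h (suc h))

module Bracketing (n : ℕ) (r : Fin (suc n) → ℕ) (P k : ℕ)
                  (r-pos : ∀ i → 0 < r i) (P-pos : 0 < P) (k-pos : 1 ≤ k) where

  s : ℕ → Fin (suc n) → ℕ
  s m i = m ℕ.* P ℕ.+ r i

  S : ℕ → ℕ
  S m = ∏ℕ (s m)

  s-pos : ∀ m i → 1 ≤ s m i
  s-pos m i = ℕₚ.≤-trans (r-pos i) (ℕₚ.m≤n+m (r i) (m ℕ.* P))

  S-pos : ∀ m → 1 ≤ S m
  S-pos m = ∏-positive (suc n) (s-pos m)

  Sseq≡S : ∀ m → Sseq (suc n) r P (+ m) ≡ + S m
  Sseq≡S m = trans (∏ℤ-cong (suc n) (λ i → cong (ℤ._+ + r i) (sym (ℤₚ.pos-* m P))))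
                   (∏ℤ-+ (suc n) (s m))

  Sseq≡S-suc : ∀ m → Sseq (suc n) r P (+ m ℤ.+ + 1) ≡ + S (suc m)
  Sseq≡S-suc m = trans (cong (λ x → Sseq (suc n) r P (+ x)) (ℕₚ.+-comm m 1)) (Sseq≡S (suc m))

  S-step : ∀ m → S m < S (suc m)
  S-step m = ∏-mono-< n (s-pos m) s-step
    where
    s-step : ∀ i → s m i < s (suc m) i
    s-step i = ℕₚ.<-≤-trans (ℕₚ.m<n+m (s m i) P-pos)
                            (ℕₚ.≤-reflexive (sym (ℕₚ.+-assoc P (m ℕ.* P) (r i))))

  s-suc-≤ : ∀ m i → s (suc m) i ≤ s k i ℕ.* s m i
  s-suc-≤ m i = begin
    P ℕ.+ m ℕ.* P ℕ.+ r i      ≡⟨ ℕₚ.+-assoc P (m ℕ.* P) (r i) ⟩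
    P ℕ.+ s m i
      ≤⟨ ℕₚ.+-monoˡ-≤ (s m i) (ℕₚ.m≤m*n P (s m i) {{ℕ.>-nonZero (s-pos m i)}}) ⟩
    P ℕ.* s m i ℕ.+ s m i      ≡⟨ ℕₚ.+-comm (P ℕ.* s m i) (s m i) ⟩
    suc P ℕ.* s m i            ≤⟨ ℕₚ.*-monoˡ-≤ (s m i) 1+P≤s[k] ⟩
    s k i ℕ.* s m i            ∎
    where
    open ℕₚ.≤-Reasoning
    1+P≤s[k] : suc P ≤ s k i
    1+P≤s[k] = ℕₚ.≤-trans (ℕₚ.+-mono-≤ (r-pos i) (ℕₚ.m≤n*m P k {{ℕ.>-nonZero k-pos}}))
                          (ℕₚ.≤-reflexive (ℕₚ.+-comm (r i) (k ℕ.* P)))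

  S-suc-≤ : ∀ m → S (suc m) ≤ S k ℕ.* S m
  S-suc-≤ m = ℕₚ.≤-trans (∏-mono-≤ (suc n) (s-suc-≤ m))
                         (ℕₚ.≤-reflexive (∏-distrib-* (s k) (s m)))

  open StrictlyIncreasing S S-step

  S₀≤S[k]^t : ∀ t → S 0 ≤ S k ℕ.^ suc t
  S₀≤S[k]^t t = ℕₚ.≤-trans (≤-mono {n = k} z≤n)
    (ℕₚ.m≤m*n (S k) (S k ℕ.^ t) {{ℕₚ.m^n≢0 (S k) t {{ℕ.>-nonZero (S-pos k)}}}})

  level : ℕ → ℕ
  level t = proj₁ (brackets (S k ℕ.^ suc t) (S₀≤S[k]^t t))

  level-brackets : ∀ t → Brackets (S k ℕ.^ suc t) (level t)
  level-brackets t = proj₂ (brackets (S k ℕ.^ suc t) (S₀≤S[k]^t t))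

  level-zero : level 0 ≡ k
  level-zero = brackets-unique (level-brackets 0) k-brackets
    where
    k-brackets : Brackets (S k ℕ.^ 1) k
    k-brackets = ℕₚ.≤-reflexive (sym (ℕₚ.*-identityʳ (S k)))
               , subst (_< S (suc k)) (sym (ℕₚ.*-identityʳ (S k))) (S-step k)

  level-step : ∀ t → level t < level (suc t)
  level-step t = brackets-index-≤
    (ℕₚ.≤-trans (S-suc-≤ (level t)) (ℕₚ.*-monoʳ-≤ (S k) (proj₁ (level-brackets t))))
    (proj₂ (level-brackets (suc t)))

  -- ℓ t is only specified for t ≥ 1; ℓ 0 is a junk value.
  ℓ : ℕ → ℤ
  ℓ zero    = + 0
  ℓ (suc t) = - (+ k) ℤ.+ + level t

  k+ℓ≡level : ∀ t → + k ℤ.+ ℓ (suc t) ≡ + level t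
  k+ℓ≡level t = \\-leftDividesˡ (+ k) (+ level t)

  Brackets-ℤ : ℕ → ℤ → Set
  Brackets-ℤ t z = Sseq (suc n) r P z ℤ.≤ Sseq (suc n) r P (+ k) ^ℤ t
                 × Sseq (suc n) r P (+ k) ^ℤ t ℤ.< Sseq (suc n) r P (z ℤ.+ + 1)

  Sseq[k]^t≡ : ∀ t → Sseq (suc n) r P (+ k) ^ℤ t ≡ + (S k ℕ.^ t)
  Sseq[k]^t≡ t = trans (cong (_^ℤ t) (Sseq≡S k)) (^ℤ-+ (S k) t)

  Brackets-ℤ⇒Brackets : ∀ t m → Brackets-ℤ t (+ m) → Brackets (S k ℕ.^ t) m
  Brackets-ℤ⇒Brackets t m (lo , hi) =
      ℤₚ.drop‿+≤+ (subst₂ ℤ._≤_ (Sseq≡S m) (Sseq[k]^t≡ t) lo)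
    , ℤₚ.drop‿+<+ (subst₂ ℤ._<_ (Sseq[k]^t≡ t) (Sseq≡S-suc m) hi)

  Brackets⇒Brackets-ℤ : ∀ t m → Brackets (S k ℕ.^ t) m → Brackets-ℤ t (+ m)
  Brackets⇒Brackets-ℤ t m (lo , hi) =
      subst₂ ℤ._≤_ (sym (Sseq≡S m)) (sym (Sseq[k]^t≡ t)) (ℤ.+≤+ lo)
    , subst₂ ℤ._<_ (sym (Sseq[k]^t≡ t)) (sym (Sseq≡S-suc m)) (ℤ.+<+ hi)

  ℓ-lower : ∀ t → - (+ k) ℤ.≤ ℓ (suc t)
  ℓ-lower t = subst (ℤ._≤ ℓ (suc t)) (ℤₚ.+-identityʳ (- (+ k)))
                    (ℤₚ.+-monoʳ-≤ (- (+ k)) (ℤ.+≤+ z≤n))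

  ℓ-brackets : ∀ t → Brackets-ℤ (suc t) (+ k ℤ.+ ℓ (suc t))
  ℓ-brackets t = subst (Brackets-ℤ (suc t)) (sym (k+ℓ≡level t))
                       (Brackets⇒Brackets-ℤ (suc t) (level t) (level-brackets t))

  ℓ-unique : ∀ t ℓ′ → - (+ k) ℤ.≤ ℓ′ →
             Sseq (suc n) r P (+ k ℤ.+ ℓ′) ℤ.≤ Sseq (suc n) r P (+ k) ^ℤ suc t →
             Sseq (suc n) r P (+ k) ^ℤ suc t ℤ.< Sseq (suc n) r P (+ k ℤ.+ ℓ′ ℤ.+ + 1) →
             ℓ′ ≡ ℓ (suc t)
  ℓ-unique t ℓ′ -k≤ℓ′ lo hi = y≈x\\z (+ k) ℓ′ (+ level t) (begin
    + k ℤ.+ ℓ′   ≡⟨ sym z≡+∣z∣ ⟩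
    + ℤ.∣ z ∣    ≡⟨ cong +_ (brackets-unique z-brackets (level-brackets t)) ⟩
    + level t    ∎)
    where
    open ≡-Reasoning
    z : ℤ
    z = + k ℤ.+ ℓ′
    z≡+∣z∣ : + ℤ.∣ z ∣ ≡ z
    z≡+∣z∣ = ℤₚ.0≤i⇒+∣i∣≡i
      (subst (ℤ._≤ z) (ℤₚ.+-inverseʳ (+ k)) (ℤₚ.+-monoʳ-≤ (+ k) -k≤ℓ′))
    z-brackets : Brackets (S k ℕ.^ suc t) ℤ.∣ z ∣
    z-brackets = Brackets-ℤ⇒Brackets (suc t) ℤ.∣ z ∣
                   (subst (Brackets-ℤ (suc t)) (sym z≡+∣z∣) (lo , hi))

  ℓ-one : ℓ 1 ≡ + 0
  ℓ-one = trans (cong (λ m → - (+ k) ℤ.+ + m) level-zero) (ℤₚ.+-inverseˡ (+ k))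

  ℓ-<-mono : ∀ t u → 1 ≤ t → t < u → ℓ t ℤ.< ℓ u
  ℓ-<-mono (suc t) (suc u) _ (s≤s t<u) =
    ℤₚ.+-monoʳ-< (- (+ k)) (ℤ.+<+ (StrictlyIncreasing.<-mono level level-step t<u))

lemma2 : (n : ℕ) → let h = suc (suc n) in
    (r : Fin h → ℕ) → (P : ℕ) → (k₁ : ℕ) →
    (∀ i j → i Fin.< j → r i < r j) →
    (∀ i → 0 < r i) →
    (∀ i j → i Fin.< j → Coprime (r i) (r j)) →
    0 < P →
    r (fromℕ (suc n)) ∸ r zero ≤ P →
    (∀ i j → i Fin.< j → ∀ p → Prime p → p ∣ (r j ∸ r i) → p ∣ P) →
    (∀ m → IsFloorInv h m → suc m ≤ k₁) →
    Σ (ℕ → ℤ) λ ℓ →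
      (∀ t → 1 ≤ t →
          (- (+ k₁) ℤ.≤ ℓ t)
        × (Sseq h r P (+ k₁ ℤ.+ ℓ t) ℤ.≤ (Sseq h r P (+ k₁) ^ℤ t))
        × ((Sseq h r P (+ k₁) ^ℤ t) ℤ.< Sseq h r P (+ k₁ ℤ.+ ℓ t ℤ.+ + 1))
        × (∀ (ℓ′ : ℤ) → - (+ k₁) ℤ.≤ ℓ′ →
             Sseq h r P (+ k₁ ℤ.+ ℓ′) ℤ.≤ (Sseq h r P (+ k₁) ^ℤ t) →
             (Sseq h r P (+ k₁) ^ℤ t) ℤ.< Sseq h r P (+ k₁ ℤ.+ ℓ′ ℤ.+ + 1) →
             ℓ′ ≡ ℓ t))
      × (ℓ 1 ≡ + 0)
      × (∀ t u → 1 ≤ t → t < u → ℓ t ℤ.< ℓ u)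
lemma2 n r P k₁ _ r-pos _ P-pos _ _ floor≤k₁ =
  ℓ , (λ { (suc t) _ → ℓ-lower t , proj₁ (ℓ-brackets t) , proj₂ (ℓ-brackets t) , ℓ-unique t })
    , ℓ-one , ℓ-<-mono
  where
  k₁-pos : 1 ≤ k₁
  k₁-pos = ℕₚ.≤-trans (s≤s z≤n) (floor≤k₁ _ (proj₂ (floorInv-exists (suc n))))
  open Bracketing (suc n) r P k₁ r-pos P-pos k₁-pos
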